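{- Let $R$ be a commutative ring with unity, let $(G,\alpha)$ be an edge-labeled graph over $R$, and let $(G',\alpha')$ be an edge-labeled subgraph of $(G,\alpha)$ such that for any $u,v\in V(G')$ we have $\mathcal{P}_{G'}(u,v)=\mathcal{P}_G(u,v)$. If $(G,\alpha)$ satisfies the Universal Difference Property, then $(G',\alpha')$ satisfies the Universal Difference Property.
   Context: All graphs are connected and all rings are commutative with unity. An edge-labeling of a graph $G$ over $R$ is a function $\alpha$ from $E(G)$ to the set of ideals of $R$. An edge-labeled subgraph $(H,\alpha')$ of $(G,\alpha)$ consists of a subgraph $H$ of $G$ with $\alpha'(e)=\alpha(e)$ for all $e\in E(H)$. A (generalized) spline on $(G,\alpha)$ is a function $\rho:V(G)\to R$ such that $\rho(u)-\rho(v)\in\alpha(uv)$ for every edge $uv$. A path has no repeated vertices; $\mathcal{P}_G(u,v)$ denotes the set of all paths in $G$ from $u$ to $v$, and for a path $P$, $\alpha(P)$ is the sum of the ideals labeling the edges of $P$. $(G,\alpha)$ satisfies the Universal Difference Property (UDP) if for every pair of vertices $u,w$ and every $x\in\bigcap_{P\in\mathcal{P}_G(u,w)}\alpha(P)$ there exists a spline $\rho$ on $(G,\alpha)$ with $\rho(u)-\rho(w)=x$. -}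

module Defs where

open import Level using (Level; _⊔_; suc; Lift)
open import Data.Empty using (⊥)
open import Algebra.Bundles using (CommutativeRing)
open import Data.Nat using (ℕ)
open import Data.Fin using (Fin)
open import Data.Bool using (Bool; true)
open import Data.List using (List; []; _∷_; head; last)
open import Data.List.Relation.Unary.Unique.Propositional using (Unique)
open import Data.Maybe using (just)
open import Data.Product using (Σ; ∃; ∃-syntax; _×_)
open import Relation.Binary.PropositionalEquality using (_≡_)

module _ {c ℓ : Level} (R : CommutativeRing c ℓ) where
  open CommutativeRing R

  record Ideal (i : Level) : Set (c ⊔ ℓ ⊔ suc i) where
    field
      _∈I      : Carrier → Set i
      ∈-resp-≈ : ∀ {x y} → x ≈ y → x ∈I → y ∈I
      0∈       : 0# ∈I
      +-closed : ∀ {x y} → x ∈I → y ∈I → (x + y) ∈I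
      *-closed : ∀ r {x} → x ∈I → (r * x) ∈I

-- Finite graphs.  A graph lives on an ambient vertex type Fin n:
-- its vertex set is the subset  Vert  and its edges are given by the
-- symmetric irreflexive relation  Adj  between vertices.

record Graph (n : ℕ) : Set where
  field
    Vert    : Fin n → Bool
    Adj     : Fin n → Fin n → Bool
    sym     : ∀ u v → Adj u v ≡ true → Adj v u ≡ true
    irrefl  : ∀ u → Adj u u ≡ true → ⊥
    adj-src : ∀ u v → Adj u v ≡ true → Vert u ≡ true
open Graph public

_⊆G_ : ∀ {n} → Graph n → Graph n → Set
H ⊆G G = (∀ v → Vert H v ≡ true → Vert G v ≡ true)
       × (∀ u v → Adj H u v ≡ true → Adj G u v ≡ true)

data IsWalk {n} (G : Graph n) : List (Fin n) → Set where
  single : ∀ v → Vert G v ≡ true → IsWalk G (v ∷ [])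
  step   : ∀ u v vs → Adj G u v ≡ true → IsWalk G (v ∷ vs) → IsWalk G (u ∷ v ∷ vs)

record IsPath {n} (G : Graph n) (u v : Fin n) (P : List (Fin n)) : Set where
  field
    walk   : IsWalk G P
    unique : Unique P
    start  : head P ≡ just u
    end    : last P ≡ just v

Connected : ∀ {n} → Graph n → Set
Connected G = ∀ u v → Vert G u ≡ true → Vert G v ≡ true → ∃[ P ] IsPath G u v P

module _ {c ℓ : Level} (R : CommutativeRing c ℓ) where
  open CommutativeRing R

  record EdgeLabeling (i : Level) (n : ℕ) : Set (c ⊔ ℓ ⊔ suc i) where
    field
      lab     : Fin n → Fin n → Ideal R i
      lab-sym : ∀ u v x → Ideal._∈I (lab u v) x → Ideal._∈I (lab v u) x
  open EdgeLabeling public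

  module _ {i : Level} {n : ℕ} (α : EdgeLabeling i n) where

    -- x ∈ α(P): membership in the sum of the ideals labelling the
    -- consecutive edges of the vertex list P (zero ideal if no edges)
    _∈αP_ : Carrier → List (Fin n) → Set (c ⊔ ℓ ⊔ i)
    x ∈αP []            = Lift (c ⊔ i) (x ≈ 0#)
    x ∈αP (_ ∷ [])      = Lift (c ⊔ i) (x ≈ 0#)
    x ∈αP (a ∷ b ∷ vs)  = ∃[ y ] ∃[ z ]
      (Ideal._∈I (lab α a b) y × (z ∈αP (b ∷ vs)) × x ≈ y + z)

    IsSpline : Graph n → (Fin n → Carrier) → Set i
    IsSpline G ρ = ∀ u v → Adj G u v ≡ true → Ideal._∈I (lab α u v) (ρ u - ρ v)

    UDP : Graph n → Set (c ⊔ ℓ ⊔ i)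
    UDP G = ∀ u w → Vert G u ≡ true → Vert G w ≡ true →
            ∀ x → (∀ P → IsPath G u w P → x ∈αP P) →
            Σ (Fin n → Carrier) λ ρ → IsSpline G ρ × (ρ u - ρ w ≈ x)

{-# OPTIONS --safe #-}
module Submission where

open import Defs
open import Level using (Level)
open import Algebra.Bundles using (CommutativeRing)
open import Data.Nat using (ℕ)
open import Data.Fin using (Fin)
open import Data.Bool using (true)
open import Relation.Binary.PropositionalEquality using (_≡_)
open import Data.Product using (_×_; _,_; proj₂)

isSpline-⊆ : {c ℓ i : Level} (R : CommutativeRing c ℓ) {n : ℕ}
  (α : EdgeLabeling R i n) (H G : Graph n) {ρ : Fin n → CommutativeRing.Carrier R} →
  H ⊆G G → IsSpline R α G ρ → IsSpline R α H ρ
isSpline-⊆ R α H G (_ , adj⊆) spline u v uv = spline u v (adj⊆ u v uv)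

theorem2p5 : {c ℓ i : Level} (R : CommutativeRing c ℓ) {n : ℕ}
    (G G' : Graph n) (α : EdgeLabeling R i n) →
    Connected G → Connected G' → G' ⊆G G →
    (∀ u v → Vert G' u ≡ true → Vert G' v ≡ true →
    ∀ P → (IsPath G' u v P → IsPath G u v P) × (IsPath G u v P → IsPath G' u v P)) →
    UDP R α G → UDP R α G'
theorem2p5 R G G' α _ _ G'⊆G@(vert⊆ , _) samePaths udp u w u∈G' w∈G' x x∈αPs
  with udp u w (vert⊆ u u∈G') (vert⊆ w w∈G') x
         (λ P path → x∈αPs P (proj₂ (samePaths u w u∈G' w∈G' P) path))
... | ρ , spline , diff≈x = ρ , isSpline-⊆ R α G' G G'⊆G spline , diff≈x
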